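{- Let $n\ge1$, $A=\{a_1,\dots,a_n\}$, $S$ the power set of $A$, and $f:S\to\mathbb{Z}_2^n$, $f(u)_j\equiv\#\{i: a_i\in u,\ i\mid j\}\pmod 2$. For $1\le k\le n$ let $u_k=\{a_i: 1\le i\le n,\ i=ks \text{ for some squarefree positive integer } s\}$. Given $u\in S$, run the procedure: set $w:=u$; while $w\neq\emptyset$, let $a_k$ be the element of $w$ with the smallest index, replace $w$ by the symmetric difference $w\oplus u_k$, and print $k$. Then the procedure terminates, and the set of printed indices $k$ is exactly $\{j: f(u)_j=1\}$, i.e. the set of lockers that are open when, starting from all lockers closed, the students of $u$ act.
   Context: Locker problem: $n$ lockers numbered $1,\dots,n$ and students $a_1,\dots,a_n$; student $a_i$ acting changes the state (open/closed) of every locker whose number is a multiple of $i$; $f(u)$ records the final state ($1$ = open). -}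

module Defs where

open import Data.Nat using (ℕ; zero; suc; _*_; _<_; _%_; _≤_)
open import Data.Nat.Divisibility using (_∣_; _∣?_)
open import Data.Fin using (Fin; toℕ)
open import Data.Bool using (Bool; true; false; _∧_; _xor_; if_then_else_)
open import Data.List using (List; []; _∷_; allFin; map)
open import Data.Nat.ListAction using (sum)
open import Data.Product using (Σ; _×_)
open import Relation.Nullary.Decidable using (⌊_⌋)
open import Relation.Binary.PropositionalEquality using (_≡_)
open import Function.Bundles using (_⇔_)

-- Students a₁,…,aₙ / lockers 1,…,n are indexed by i : Fin n, standing
-- for the number toℕ i + 1.  A subset of A = {a₁,…,aₙ} is a map Fin n → Bool.
Subset : ℕ → Set
Subset n = Fin n → Bool

num : ∀ {n} → Fin n → ℕ
num i = suc (toℕ i)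

_⊕_ : ∀ {n} → Subset n → Subset n → Subset n
(w ⊕ v) i = w i xor v i

countDiv : ∀ {n} → Subset n → Fin n → ℕ
countDiv {n} u j =
  sum (map (λ i → if u i ∧ ⌊ num i ∣? num j ⌋ then 1 else 0) (allFin n))

f : ∀ {n} → Subset n → Fin n → ℕ
f u j = countDiv u j % 2

SquareFree : ℕ → Set
SquareFree s = (d : ℕ) → d * d ∣ s → d ≡ 1

IsUFamily : ∀ {n} → (Fin n → Subset n) → Set
IsUFamily {n} U = (k i : Fin n) →
  (U k i ≡ true) ⇔ Σ ℕ (λ s → (1 ≤ s × SquareFree s) × num i ≡ num k * s)

-- Run U w ks : the procedure started with w := w terminates having
-- printed the list ks (printed k is the index k, i.e. number num k).
data Run {n} (U : Fin n → Subset n) : Subset n → List (Fin n) → Set where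
  done : ∀ {w} → ((i : Fin n) → w i ≡ false) → Run U w []
  step : ∀ {w ks} (k : Fin n) →
         w k ≡ true →
         ((i : Fin n) → toℕ i < toℕ k → w i ≡ false) →
         Run U (w ⊕ U k) ks →
         Run U w (k ∷ ks)

module Submission where

-- Over ℤ₂ the map f is linear, f (w ⊕ v) = f w + f v: the togglers of a locker
-- in w ⊕ v are those of w plus those of v minus twice the common ones.  The
-- sets u_k are dual to the lockers: f (u_k) is the indicator of locker k.  The
-- students of u_k toggling locker j = k·m are those numbered k·s, s a
-- squarefree divisor of m; for m = 1 that is k alone, and for m > 1 a prime
-- p ∣ m pairs these divisors off by s ↦ s·p or s/p.  Finally the least element
-- k of a nonempty w is open in f w.  So each step prints an open locker k and
-- closes exactly that one; induction on the number of open lockers concludes.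

open import Defs
open import Data.Nat using (ℕ; zero; suc; _+_; _*_; _/_; _%_; _<_; _≤_; _<?_; z≤n; s≤s; NonZero; >-nonZero; nonTrivial⇒n>1)
open import Data.Nat.Properties
  using (suc-injective; +-suc; +-comm; +-identityʳ; *-comm; *-assoc; *-identityʳ; *-distribʳ-+;
         +-commutativeSemigroup; *-cancelˡ-≡; m<m*n; <-irrefl; <⇒≢; ≤-trans; 0≢1+n;
         m≤n⇒m<n∨m≡n; m*n≡1⇒m≡1; *-mono-≤)
  renaming (_≟_ to _≟ℕ_)
open import Data.Nat.DivMod using (%-distribˡ-+; m%n%n≡m%n; [m+n]%n≡m%n; [m+kn]%n≡m%n; m*n/n≡m)
open import Data.Nat.Divisibility
  using (_∣_; _∣?_; divides; ∣-refl; ∣-trans; ∣⇒≤; ∣1⇒≡1; _∣0; n∣m*n; m∣m*n; *-pres-∣; *-monoʳ-∣;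
         *-monoˡ-∣; *-cancelˡ-∣; *-cancelʳ-∣)
open import Data.Nat.Primality using (Prime; euclidsLemma; prime⇒irreducible; prime⇒nonZero; prime⇒nonTrivial)
open import Data.Nat.Primality.Factorisation using (factorise)
open import Data.Nat.Coprimality using (Coprime; coprime-divisor)
open import Data.Nat.ListAction using (sum; product)
open import Data.Fin using (Fin; toℕ; zero; suc; _≟_; fromℕ<)
open import Data.Fin.Properties using (toℕ-injective; toℕ-fromℕ<; toℕ<n) renaming (suc-injective to fsuc-injective)
open import Data.Bool using (Bool; true; false; _∧_; _xor_; if_then_else_)
open import Data.Bool.Properties using (∧-distribʳ-xor; ¬-not)
open import Data.List using (List; []; _∷_; allFin; map; tabulate)
open import Data.List.Properties using (map-tabulate)
open import Data.List.Relation.Unary.All using (_∷_)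
open import Data.List.Relation.Unary.Any using (here; there)
open import Data.List.Membership.Propositional using (_∈_)
open import Data.Product using (Σ; _×_; _,_; proj₁; proj₂)
open import Data.Sum using (_⊎_; inj₁; inj₂)
open import Relation.Nullary using (¬_; yes; no; Dec; contradiction)
open import Relation.Nullary.Decidable using (⌊_⌋; dec-true; dec-false; isYes≗does)
open import Relation.Binary.PropositionalEquality
  using (_≡_; _≢_; refl; sym; trans; cong; cong₂; subst; subst₂; module ≡-Reasoning)
open import Function using (_∘_; id)
open import Function.Bundles using (_⇔_; mk⇔; Equivalence)
open import Algebra.Properties.CommutativeSemigroup +-commutativeSemigroup using (interchange)

open ≡-Reasoning

⌊⌋-yes : ∀ {A : Set} (a? : Dec A) → A → ⌊ a? ⌋ ≡ true
⌊⌋-yes a? a = trans (isYes≗does a?) (dec-true a? a)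

⌊⌋-no : ∀ {A : Set} (a? : Dec A) → ¬ A → ⌊ a? ⌋ ≡ false
⌊⌋-no a? ¬a = trans (isYes≗does a?) (dec-false a? ¬a)

indicator : Bool → ℕ
indicator b = if b then 1 else 0

count : ∀ {n} → (Fin n → Bool) → ℕ
count {zero}  P = 0
count {suc n} P = indicator (P zero) + count (P ∘ suc)

sum-indicators : ∀ {n} (P : Fin n → Bool) → sum (map (indicator ∘ P) (allFin n)) ≡ count P
sum-indicators {zero}  P = refl
sum-indicators {suc n} P = cong (indicator (P zero) +_) (begin
  sum (map (indicator ∘ P) (tabulate suc))      ≡⟨ cong sum (map-tabulate suc (indicator ∘ P)) ⟩
  sum (tabulate (indicator ∘ P ∘ suc))          ≡⟨ cong sum (map-tabulate id (indicator ∘ P ∘ suc)) ⟨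
  sum (map (indicator ∘ P ∘ suc) (allFin n))    ≡⟨ sum-indicators (P ∘ suc) ⟩
  count (P ∘ suc)                               ∎)

count-ext : ∀ {n} (P Q : Fin n → Bool) → (∀ i → P i ≡ Q i) → count P ≡ count Q
count-ext {zero}  P Q P≗Q = refl
count-ext {suc n} P Q P≗Q = cong₂ _+_ (cong indicator (P≗Q zero)) (count-ext (P ∘ suc) (Q ∘ suc) (P≗Q ∘ suc))

count-none : ∀ {n} (P : Fin n → Bool) → (∀ i → P i ≡ false) → count P ≡ 0
count-none {zero}  P none = refl
count-none {suc n} P none rewrite none zero = count-none (P ∘ suc) (none ∘ suc)

count-flip : ∀ {n} (P Q : Fin n → Bool) (x : Fin n) → P x ≡ true → Q x ≡ false →
             (∀ i → i ≢ x → P i ≡ Q i) → count P ≡ suc (count Q)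
count-flip P Q zero Px Qx same rewrite Px | Qx =
  cong suc (count-ext (P ∘ suc) (Q ∘ suc) (λ i → same (suc i) λ ()))
count-flip P Q (suc x) Px Qx same = begin
  indicator (P zero) + count (P ∘ suc)        ≡⟨ cong₂ _+_ (cong indicator (same zero λ ())) rest ⟩
  indicator (Q zero) + suc (count (Q ∘ suc))  ≡⟨ +-suc (indicator (Q zero)) (count (Q ∘ suc)) ⟩
  suc (count Q)                               ∎
  where
  rest : count (P ∘ suc) ≡ suc (count (Q ∘ suc))
  rest = count-flip (P ∘ suc) (Q ∘ suc) x Px Qx (λ i i≢x → same (suc i) (i≢x ∘ fsuc-injective))

count-singleton : ∀ {n} (P : Fin n → Bool) (x : Fin n) → P x ≡ true →
                  (∀ i → P i ≡ true → i ≡ x) → count P ≡ 1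
count-singleton {n} P x Px only = begin
  count P               ≡⟨ count-flip P nothing x Px refl (λ i i≢x → ¬-not (i≢x ∘ only i)) ⟩
  suc (count nothing)   ≡⟨ cong suc (count-none nothing λ _ → refl) ⟩
  1                     ∎
  where
  nothing : Fin n → Bool
  nothing _ = false

count-xor : ∀ {n} (P Q : Fin n → Bool) →
            count (λ i → P i xor Q i) + count (λ i → P i ∧ Q i) * 2 ≡ count P + count Q
count-xor {zero}  P Q = refl
count-xor {suc n} P Q = begin
  (x + X) + (y + Y) * 2      ≡⟨ cong ((x + X) +_) (*-distribʳ-+ 2 y Y) ⟩
  (x + X) + (y * 2 + Y * 2)  ≡⟨ interchange x X (y * 2) (Y * 2) ⟩
  (x + y * 2) + (X + Y * 2)  ≡⟨ cong₂ _+_ (pointwise (P zero) (Q zero)) (count-xor (P ∘ suc) (Q ∘ suc)) ⟩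
  (a + b) + (A + B)          ≡⟨ interchange a b A B ⟩
  (a + A) + (b + B)          ∎
  where
  x = indicator (P zero xor Q zero)
  y = indicator (P zero ∧ Q zero)
  X = count (λ i → P (suc i) xor Q (suc i))
  Y = count (λ i → P (suc i) ∧ Q (suc i))
  a = indicator (P zero)
  b = indicator (Q zero)
  A = count (P ∘ suc)
  B = count (Q ∘ suc)
  pointwise : ∀ c d → indicator (c xor d) + indicator (c ∧ d) * 2 ≡ indicator c + indicator d
  pointwise false false = refl
  pointwise false true  = refl
  pointwise true  false = refl
  pointwise true  true  = refl

count-xor-parity : ∀ {n} (P Q : Fin n → Bool) →
                   count (λ i → P i xor Q i) % 2 ≡ (count P + count Q) % 2
count-xor-parity P Q = begin
  count (λ i → P i xor Q i) % 2                                   ≡⟨ [m+kn]%n≡m%n (count (λ i → P i xor Q i)) (count (λ i → P i ∧ Q i)) 2 ⟨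
  (count (λ i → P i xor Q i) + count (λ i → P i ∧ Q i) * 2) % 2   ≡⟨ cong (_% 2) (count-xor P Q) ⟩
  (count P + count Q) % 2                                         ∎

IsLeast : ∀ {n} → Subset n → Fin n → Set
IsLeast {n} w k = w k ≡ true × ((i : Fin n) → toℕ i < toℕ k → w i ≡ false)

empty-or-least : ∀ {n} (w : Subset n) → ((i : Fin n) → w i ≡ false) ⊎ Σ (Fin n) (IsLeast w)
empty-or-least {zero}  w = inj₁ λ ()
empty-or-least {suc n} w with w zero in w₀ | empty-or-least (w ∘ suc)
... | true  | _                    = inj₂ (zero , w₀ , λ _ ())
... | false | inj₁ none            = inj₁ λ { zero → w₀ ; (suc i) → none i }
... | false | inj₂ (k , wk , below) =
  inj₂ (suc k , wk , λ { zero _ → w₀ ; (suc i) (s≤s i<k) → below i i<k })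

record Pairing {n} (P : Fin n → Bool) (σ : Fin n → Fin n) : Set where
  field
    closed     : ∀ i → P i ≡ true → P (σ i) ≡ true
    involutive : ∀ i → P i ≡ true → σ (σ i) ≡ i
    moves      : ∀ i → P i ≡ true → σ i ≢ i

remove : ∀ {n} → (Fin n → Bool) → Fin n → Fin n → Bool
remove P x i = if ⌊ i ≟ x ⌋ then false else P i

remove-sound : ∀ {n} (P : Fin n → Bool) x i → remove P x i ≡ true → P i ≡ true × i ≢ x
remove-sound P x i kept with i ≟ x
... | no i≢x = kept , i≢x

remove-intro : ∀ {n} (P : Fin n → Bool) x i → P i ≡ true → i ≢ x → remove P x i ≡ true
remove-intro P x i Pi i≢x rewrite ⌊⌋-no (i ≟ x) i≢x = Pi

count-remove : ∀ {n} (P : Fin n → Bool) x → P x ≡ true → count P ≡ suc (count (remove P x))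
count-remove P x Px = count-flip P (remove P x) x Px removed kept
  where
  removed : remove P x x ≡ false
  removed rewrite ⌊⌋-yes (x ≟ x) refl = refl
  kept : ∀ i → i ≢ x → P i ≡ remove P x i
  kept i i≢x rewrite ⌊⌋-no (i ≟ x) i≢x = refl

module _ {n} {P : Fin n → Bool} {σ : Fin n → Fin n} (pairing : Pairing P σ) where
  open Pairing pairing

  removePair : Fin n → Fin n → Bool
  removePair x = remove (remove P x) (σ x)

  count-removePair : ∀ x → P x ≡ true → count P ≡ 2 + count (removePair x)
  count-removePair x Px = begin
    count P                       ≡⟨ count-remove P x Px ⟩
    suc (count (remove P x))      ≡⟨ cong suc (count-remove (remove P x) (σ x) σx-left) ⟩
    2 + count (removePair x)      ∎
    where
    σx-left : remove P x (σ x) ≡ true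
    σx-left = remove-intro P x (σ x) (closed x Px) (moves x Px)

  pairing-removePair : ∀ x → P x ≡ true → Pairing (removePair x) σ
  pairing-removePair x Px = record
    { closed     = λ i Qi → let (Pi , i≢x , i≢σx) = sound i Qi in
        remove-intro (remove P x) (σ x) (σ i)
          (remove-intro P x (σ i) (closed i Pi) λ σi≡x → i≢σx (trans (sym (involutive i Pi)) (cong σ σi≡x)))
          (λ σi≡σx → i≢x (trans (sym (involutive i Pi)) (trans (cong σ σi≡σx) (involutive x Px))))
    ; involutive = λ i Qi → involutive i (proj₁ (sound i Qi))
    ; moves      = λ i Qi → moves i (proj₁ (sound i Qi))
    }
    where
    sound : ∀ i → removePair x i ≡ true → P i ≡ true × i ≢ x × i ≢ σ x
    sound i Qi with remove-sound (remove P x) (σ x) i Qi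
    ... | (Ri , i≢σx) with remove-sound P x i Ri
    ...   | (Pi , i≢x) = Pi , i≢x , i≢σx

-- The count of a paired family is even: remove pairs {x, σ x} one at a time
-- (recursion on the current count N).
pairing⇒even : ∀ {n} N (P : Fin n → Bool) (σ : Fin n → Fin n) →
               Pairing P σ → count P ≡ N → count P % 2 ≡ 0
pairing⇒even N P σ pairing count≡N with empty-or-least P
... | inj₁ none = cong (_% 2) (count-none P none)
... | inj₂ (x , Px , _) with N | trans (sym count≡N) (count-removePair pairing x Px)
...   | suc (suc N′) | N≡2+rest = begin
  count P % 2                            ≡⟨ cong (_% 2) (count-removePair pairing x Px) ⟩
  (2 + count (removePair pairing x)) % 2 ≡⟨ cong (_% 2) (+-comm 2 (count (removePair pairing x))) ⟩
  (count (removePair pairing x) + 2) % 2 ≡⟨ [m+n]%n≡m%n (count (removePair pairing x)) 2 ⟩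
  count (removePair pairing x) % 2       ≡⟨ pairing⇒even N′ _ σ (pairing-removePair pairing x Px)
                                              (sym (suc-injective (suc-injective N≡2+rest))) ⟩
  0                                      ∎

togglers : ∀ {n} → Subset n → Fin n → Fin n → Bool
togglers u j i = u i ∧ ⌊ num i ∣? num j ⌋

togglers-sound : ∀ {n} (u : Subset n) j i → togglers u j i ≡ true → u i ≡ true × num i ∣ num j
togglers-sound u j i t with u i | num i ∣? num j
... | true | yes i∣j = refl , i∣j

togglers-intro : ∀ {n} (u : Subset n) j i → u i ≡ true → num i ∣ num j → togglers u j i ≡ true
togglers-intro u j i ui i∣j rewrite ui | ⌊⌋-yes (num i ∣? num j) i∣j = refl

f-count : ∀ {n} (u : Subset n) j → f u j ≡ count (togglers u j) % 2
f-count u j = cong (_% 2) (sum-indicators (togglers u j))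

-- f is ℤ₂-linear: the togglers of w ⊕ v are the xor of those of w and v
f-linear : ∀ {n} (w v : Subset n) j → f (w ⊕ v) j ≡ (f w j + f v j) % 2
f-linear w v j = begin
  f (w ⊕ v) j                                             ≡⟨ f-count (w ⊕ v) j ⟩
  count (togglers (w ⊕ v) j) % 2                          ≡⟨ cong (_% 2) (count-ext _ _ λ i → ∧-distribʳ-xor _ (w i) (v i)) ⟩
  count (λ i → togglers w j i xor togglers v j i) % 2     ≡⟨ count-xor-parity (togglers w j) (togglers v j) ⟩
  (count (togglers w j) + count (togglers v j)) % 2       ≡⟨ %-distribˡ-+ (count (togglers w j)) _ 2 ⟩
  (count (togglers w j) % 2 + count (togglers v j) % 2) % 2 ≡⟨ cong₂ (λ a b → (a + b) % 2) (f-count w j) (f-count v j) ⟨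
  (f w j + f v j) % 2                                     ∎

f-empty : ∀ {n} {w : Subset n} → (∀ i → w i ≡ false) → ∀ j → f w j ≡ 0
f-empty {w = w} empty j =
  trans (f-count w j) (cong (_% 2) (count-none (togglers w j) λ i → cong (_∧ _) (empty i)))

num-injective : ∀ {n} {i j : Fin n} → num i ≡ num j → i ≡ j
num-injective = toℕ-injective ∘ suc-injective

-- Only the least student k of w toggles locker k, so locker k ends open.
least-is-open : ∀ {n} {w : Subset n} {k} → IsLeast w k → f w k ≡ 1
least-is-open {w = w} {k} (wk , below) = begin
  f w k                       ≡⟨ f-count w k ⟩
  count (togglers w k) % 2    ≡⟨ cong (_% 2) (count-singleton (togglers w k) k (togglers-intro w k k wk ∣-refl) only-k) ⟩
  1                           ∎
  where
  only-k : ∀ i → togglers w k i ≡ true → i ≡ k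
  only-k i t with togglers-sound w k i t
  ... | (wi , i∣k) with m≤n⇒m<n∨m≡n (∣⇒≤ i∣k)
  ...   | inj₂ i≡k          = num-injective i≡k
  ...   | inj₁ (s≤s i<k)    = contradiction (trans (sym (below i i<k)) wi) λ ()

squarefree-1 : SquareFree 1
squarefree-1 d d²∣1 = m*n≡1⇒m≡1 d d (∣1⇒≡1 d²∣1)

squarefree-positive : ∀ {s} → SquareFree s → 1 ≤ s
squarefree-positive {zero}  sf = contradiction (sf 2 (4 ∣0)) λ ()
squarefree-positive {suc s} sf = s≤s z≤n

squarefree-∣ : ∀ {q s} → SquareFree s → q ∣ s → SquareFree q
squarefree-∣ sf q∣s d d²∣q = sf d (∣-trans d²∣q q∣s)

prime-∤⇒coprime : ∀ {p n} → Prime p → ¬ p ∣ n → Coprime n p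
prime-∤⇒coprime p-prime p∤n (e∣n , e∣p) with prime⇒irreducible p-prime e∣p
... | inj₁ e≡1 = e≡1
... | inj₂ refl = contradiction e∣n p∤n

squarefree-*prime : ∀ {p s} → Prime p → SquareFree s → ¬ p ∣ s → SquareFree (s * p)
squarefree-*prime {p} {s} p-prime sf p∤s d d²∣sp with p ∣? d
... | yes p∣d = contradiction (*-cancelʳ-∣ p {{prime⇒nonZero p-prime}} (∣-trans (*-pres-∣ p∣d p∣d) d²∣sp)) p∤s
... | no  p∤d = sf d (coprime-divisor (prime-∤⇒coprime p-prime p∤d²) (subst (d * d ∣_) (*-comm s p) d²∣sp))
  where
  p∤d² : ¬ p ∣ d * d
  p∤d² p∣d² with euclidsLemma d d p-prime p∣d²
  ... | inj₁ p∣d = p∤d p∣d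
  ... | inj₂ p∣d = p∤d p∣d

squarefree-*prime⇒∤ : ∀ {p q} → Prime p → SquareFree (q * p) → ¬ p ∣ q
squarefree-*prime⇒∤ {p} p-prime sf p∣q =
  <⇒≢ (nonTrivial⇒n>1 p {{prime⇒nonTrivial p-prime}}) (sym (sf p (*-monoˡ-∣ p p∣q)))

∣-*prime : ∀ {p m s} → Prime p → p ∣ m → s ∣ m → ¬ p ∣ s → s * p ∣ m
∣-*prime {p} {s = s} p-prime p∣m (divides r refl) p∤s with euclidsLemma r s p-prime p∣m
... | inj₂ p∣s = contradiction p∣s p∤s
... | inj₁ (divides r′ refl) = divides r′ (begin
  r′ * p * s    ≡⟨ *-assoc r′ p s ⟩
  r′ * (p * s)  ≡⟨ cong (r′ *_) (*-comm p s) ⟩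
  r′ * (s * p)  ∎)

prime-divisor : ∀ m → 1 < m → Σ ℕ (λ p → Prime p × p ∣ m)
prime-divisor m@(suc _) 1<m with factorise m
... | record { factors = [] ; isFactorisation = m≡1 } = contradiction (sym m≡1) (<⇒≢ 1<m)
... | record { factors = p ∷ ps ; isFactorisation = m≡p·ps ; factorsPrime = p-prime ∷ _ } =
  p , p-prime , subst (p ∣_) (sym m≡p·ps) (m∣m*n (product ps))

SqfDivisor : ℕ → ℕ → Set
SqfDivisor m s = SquareFree s × s ∣ m

-- For a prime p ∣ m, toggling the factor p is a fixed-point-free involution
-- of the squarefree divisors of m.
module Toggle {p : ℕ} (p-prime : Prime p) {m : ℕ} (p∣m : p ∣ m) where

  instance
    p≢0 : NonZero p
    p≢0 = prime⇒nonZero p-prime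

  -- so that toggling really changes s
  1<p : 1 < p
  1<p = nonTrivial⇒n>1 p {{prime⇒nonTrivial p-prime}}

  toggle : ℕ → ℕ
  toggle s = if ⌊ p ∣? s ⌋ then s / p else s * p

  toggle-∣ : ∀ q → toggle (q * p) ≡ q
  toggle-∣ q rewrite ⌊⌋-yes (p ∣? q * p) (n∣m*n q) = m*n/n≡m q p

  toggle-∤ : ∀ {s} → ¬ p ∣ s → toggle s ≡ s * p
  toggle-∤ {s} p∤s rewrite ⌊⌋-no (p ∣? s) p∤s = refl

  toggle-sqfDivisor : ∀ {s} → SqfDivisor m s → SqfDivisor m (toggle s)
  toggle-sqfDivisor {s} (sf , s∣m) with p ∣? s
  ... | yes (divides q refl) rewrite m*n/n≡m q p {{p≢0}} = squarefree-∣ sf (m∣m*n p) , ∣-trans (m∣m*n p) s∣m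
  ... | no p∤s = squarefree-*prime p-prime sf p∤s , ∣-*prime p-prime p∣m s∣m p∤s

  toggle-involutive : ∀ {s} → SquareFree s → toggle (toggle s) ≡ s
  toggle-involutive {s} sf with p ∣? s
  ... | yes (divides q refl) rewrite m*n/n≡m q p {{p≢0}} = toggle-∤ (squarefree-*prime⇒∤ p-prime sf)
  ... | no p∤s = toggle-∣ s

  toggle-moves : ∀ {s} → SquareFree s → toggle s ≢ s
  toggle-moves {s} sf with p ∣? s
  ... | yes (divides q refl) rewrite m*n/n≡m q p {{p≢0}} = λ q≡qp →
    <-irrefl q≡qp (m<m*n q p {{>-nonZero (squarefree-positive (squarefree-∣ sf (m∣m*n p)))}} 1<p)
  ... | no p∤s = λ sp≡s →
    <-irrefl (sym sp≡s) (m<m*n s p {{>-nonZero (squarefree-positive sf)}} 1<p)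

-- the index numbered a, or the default d when a is out of range; used to
-- transport the toggle from numbers to indices
indexOf : ∀ {n} → ℕ → Fin n → Fin n
indexOf         zero    d = d
indexOf {n}     (suc a) d with a <? n
... | yes a<n = fromℕ< a<n
... | no  _   = d

num-indexOf : ∀ {n} a (d : Fin n) → 1 ≤ a → a ≤ n → num (indexOf a d) ≡ a
num-indexOf {n} (suc a) d _ a<n with a <? n
... | yes a<n′ = cong suc (toℕ-fromℕ< a<n′)
... | no  a≮n  = contradiction a<n a≮n

module Togglers-of-u {n} {U : Fin n → Subset n} (U-family : IsUFamily U)
                     {k j : Fin n} {m : ℕ} (j≡km : num j ≡ num k * m) where

  togglers⇒divisor : ∀ {i} → togglers (U k) j i ≡ true → Σ ℕ (λ s → SqfDivisor m s × num i ≡ num k * s)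
  togglers⇒divisor {i} t with togglers-sound (U k) j i t
  ... | (ui , i∣j) with Equivalence.to (U-family k i) ui
  ...   | (s , (_ , sf) , i≡ks) = s , (sf , *-cancelˡ-∣ (num k) (subst₂ _∣_ i≡ks j≡km i∣j)) , i≡ks

  divisor⇒togglers : ∀ {i s} → SqfDivisor m s → num i ≡ num k * s → togglers (U k) j i ≡ true
  divisor⇒togglers {i} {s} (sf , s∣m) i≡ks = togglers-intro (U k) j i
    (Equivalence.from (U-family k i) (s , (squarefree-positive sf , sf) , i≡ks))
    (subst₂ _∣_ (sym i≡ks) (sym j≡km) (*-monoʳ-∣ (num k) s∣m))

  module _ {p} (p-prime : Prime p) (p∣m : p ∣ m) where
    open Toggle p-prime p∣m

    partner : Fin n → Fin n
    partner i = indexOf (num k * toggle (num i / num k)) i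

    num-partner : ∀ i s → SqfDivisor m s → num i ≡ num k * s → num (partner i) ≡ num k * toggle s
    num-partner i s d i≡ks = begin
      num (partner i)                             ≡⟨ cong (λ a → num (indexOf (num k * toggle a) i)) i/k≡s ⟩
      num (indexOf (num k * toggle s) i)          ≡⟨ num-indexOf _ i positive bounded ⟩
      num k * toggle s                            ∎
      where
      i/k≡s : num i / num k ≡ s
      i/k≡s = trans (cong (_/ num k) (trans i≡ks (*-comm (num k) s))) (m*n/n≡m s (num k))
      d′ = toggle-sqfDivisor d
      positive : 1 ≤ num k * toggle s
      positive = *-mono-≤ {1} {num k} (s≤s z≤n) (squarefree-positive (proj₁ d′))
      bounded : num k * toggle s ≤ n
      bounded = ≤-trans (∣⇒≤ (subst (num k * toggle s ∣_) (sym j≡km) (*-monoʳ-∣ (num k) (proj₂ d′)))) (toℕ<n j)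

    partner-pairing : Pairing (togglers (U k) j) partner
    partner-pairing = record
      { closed = λ i t → let (s , d , i≡ks) = togglers⇒divisor t in
          divisor⇒togglers (toggle-sqfDivisor d) (num-partner i s d i≡ks)
      ; involutive = λ i t → let (s , d , i≡ks) = togglers⇒divisor t in num-injective (begin
          num (partner (partner i))    ≡⟨ num-partner (partner i) (toggle s) (toggle-sqfDivisor d) (num-partner i s d i≡ks) ⟩
          num k * toggle (toggle s)    ≡⟨ cong (num k *_) (toggle-involutive (proj₁ d)) ⟩
          num k * s                    ≡⟨ i≡ks ⟨
          num i                        ∎)
      ; moves = λ i t partner-i≡i → let (s , d , i≡ks) = togglers⇒divisor t in
          toggle-moves (proj₁ d) (*-cancelˡ-≡ (toggle s) s (num k)
            (trans (sym (num-partner i s d i≡ks)) (trans (cong num partner-i≡i) i≡ks)))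
      }

-- f (u_k) is the indicator of locker k: k is its only toggler inside u_k …
f-u-diagonal : ∀ {n} {U : Fin n → Subset n} → IsUFamily U → ∀ k → f (U k) k ≡ 1
f-u-diagonal {U = U} U-family k = begin
  f (U k) k                        ≡⟨ f-count (U k) k ⟩
  count (togglers (U k) k) % 2     ≡⟨ cong (_% 2) (count-singleton _ k k-toggles only-k) ⟩
  1                                ∎
  where
  open Togglers-of-u U-family {k} {k} {1} (sym (*-identityʳ (num k)))
  k-toggles : togglers (U k) k k ≡ true
  k-toggles = divisor⇒togglers (squarefree-1 , ∣-refl) (sym (*-identityʳ (num k)))
  only-k : ∀ i → togglers (U k) k i ≡ true → i ≡ k
  only-k i t with togglers⇒divisor t
  ... | (s , (_ , s∣1) , i≡ks) = num-injective (trans i≡ks (trans (cong (num k *_) (∣1⇒≡1 s∣1)) (*-identityʳ (num k))))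

-- … and any other locker j has none (k ∤ j), or an even number of them
-- (j = k·m with m > 1, paired by the toggle at a prime p ∣ m)
f-u-off-diagonal : ∀ {n} {U : Fin n → Subset n} → IsUFamily U → ∀ k j → j ≢ k → f (U k) j ≡ 0
f-u-off-diagonal {U = U} U-family k j j≢k = trans (f-count (U k) j) (parity (num k ∣? num j))
  where
  parity : Dec (num k ∣ num j) → count (togglers (U k) j) % 2 ≡ 0
  parity (no k∤j) = cong (_% 2) (count-none _ λ i → ¬-not λ t →
    let (ui , i∣j) = togglers-sound (U k) j i t
        (s , _ , i≡ks) = Equivalence.to (U-family k i) ui
    in k∤j (∣-trans (subst (num k ∣_) (sym i≡ks) (m∣m*n s)) i∣j))
  parity (yes (divides (suc zero) j≡k)) = contradiction (num-injective (trans j≡k (+-identityʳ (num k)))) j≢k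
  parity (yes (divides m@(suc (suc _)) j≡mk)) with prime-divisor m (s≤s (s≤s z≤n))
  ... | (p , p-prime , p∣m) = pairing⇒even _ _ _ (partner-pairing p-prime p∣m) refl
    where open Togglers-of-u U-family {k} {j} {m} (trans j≡mk (*-comm m (num k)))

module Procedure {n} (U : Fin n → Subset n)
                 (u-diagonal : ∀ k → f (U k) k ≡ 1)
                 (u-off-diagonal : ∀ k j → j ≢ k → f (U k) j ≡ 0) where

  isOpen : Subset n → Fin n → Bool
  isOpen w j = ⌊ f w j ≟ℕ 1 ⌋

  step-closes : ∀ {w k} → f w k ≡ 1 → f (w ⊕ U k) k ≡ 0
  step-closes {w} {k} k-open = begin
    f (w ⊕ U k) k               ≡⟨ f-linear w (U k) k ⟩
    (f w k + f (U k) k) % 2     ≡⟨ cong₂ (λ a b → (a + b) % 2) k-open (u-diagonal k) ⟩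
    0                           ∎

  step-keeps : ∀ {w k j} → j ≢ k → f (w ⊕ U k) j ≡ f w j
  step-keeps {w} {k} {j} j≢k = begin
    f (w ⊕ U k) j               ≡⟨ f-linear w (U k) j ⟩
    (f w j + f (U k) j) % 2     ≡⟨ cong (λ b → (f w j + b) % 2) (u-off-diagonal k j j≢k) ⟩
    (f w j + 0) % 2             ≡⟨ cong (_% 2) (+-identityʳ (f w j)) ⟩
    f w j % 2                   ≡⟨ m%n%n≡m%n (countDiv w j) 2 ⟩
    f w j                       ∎

  count-open-step : ∀ {w k} → f w k ≡ 1 → count (isOpen w) ≡ suc (count (isOpen (w ⊕ U k)))
  count-open-step {w} {k} k-open = count-flip (isOpen w) (isOpen (w ⊕ U k)) k
    (⌊⌋-yes (f w k ≟ℕ 1) k-open)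
    (⌊⌋-no (f (w ⊕ U k) k ≟ℕ 1) (0≢1+n ∘ trans (sym (step-closes k-open))))
    (λ i i≢k → cong (λ v → ⌊ v ≟ℕ 1 ⌋) (sym (step-keeps i≢k)))

  -- the run from w prints exactly the lockers open for w; by induction on
  -- the number N of open lockers, which each step lowers by one
  run : ∀ N (w : Subset n) → count (isOpen w) ≡ N →
        Σ (List (Fin n)) (λ ks → Run U w ks × ((j : Fin n) → (j ∈ ks) ⇔ (f w j ≡ 1)))
  run N w count≡N with empty-or-least w
  ... | inj₁ empty = [] , done empty , λ j → mk⇔ (λ ()) (λ j-open → contradiction (trans (sym (f-empty empty j)) j-open) 0≢1+n)
  run zero w count≡0 | inj₂ (k , least) =
    contradiction (trans (sym count≡0) (count-open-step (least-is-open least))) 0≢1+n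
  run (suc N) w count≡1+N | inj₂ (k , least@(wk , below)) with
    run N (w ⊕ U k) (suc-injective (trans (sym (count-open-step (least-is-open least))) count≡1+N))
  ... | (ks , rest , prints) = k ∷ ks , step k wk below rest , λ j → mk⇔ (printed⇒open j) (open⇒printed j)
    where
    printed⇒open : ∀ j → j ∈ k ∷ ks → f w j ≡ 1
    printed⇒open j (here refl) = least-is-open least
    printed⇒open j (there j∈ks) with j ≟ k
    ... | yes refl = least-is-open least
    ... | no  j≢k  = trans (sym (step-keeps j≢k)) (Equivalence.to (prints j) j∈ks)
    open⇒printed : ∀ j → f w j ≡ 1 → j ∈ k ∷ ks
    open⇒printed j j-open with j ≟ k
    ... | yes refl = here refl
    ... | no  j≢k  = there (Equivalence.from (prints j) (trans (step-keeps j≢k) j-open))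

mainTheorem10 : (n : ℕ) → 1 ≤ n → (U : Fin n → Subset n) → IsUFamily U →
    (u : Subset n) →
    Σ (List (Fin n)) (λ ks → Run U u ks × ((j : Fin n) → (j ∈ ks) ⇔ (f u j ≡ 1)))
mainTheorem10 n _ U U-family u =
  Procedure.run U (f-u-diagonal U-family) (f-u-off-diagonal U-family) _ u refl
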